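{- Let $k,r\ge 0$ be integers and let $T$ be a tree with $n\le 2^r+2$ vertices and $l<k$ leaves, precolored so that exactly its leaves are colored (with colors red, blue, green), where this partial coloring does not extend to a proper 3-coloring of $T$. Then Spoiler has a winning strategy in $\mathcal G^k_r(T)$.
   Context: The game $\mathcal G^k_r(H)$ on a graph $H$ in which at most $k$ vertices are precolored with colors from $\{\text{red},\text{blue},\text{green}\}$: starting from the given partial coloring, in each of $r$ rounds Spoiler may erase the color of a colored vertex and then selects a vertex, which Duplicator colors red, blue or green; at most $k$ vertices may be colored after each round. Duplicator wins if the partial coloring is proper (no two adjacent vertices with the same color) initially and after each of the $r$ rounds; otherwise Spoiler wins. -}

module Defs where

open import Data.Nat using (ℕ; zero; suc; _+_; _≤_; _<_)
open import Data.Fin using (Fin)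
open import Data.Bool using (Bool; true; false; if_then_else_)
open import Data.Maybe using (Maybe; just; nothing; is-just)
open import Data.List using (List; []; _∷_; length; filter; allFin; map; sum)
open import Data.List.Relation.Unary.Unique.Propositional using (Unique)
open import Data.Product using (Σ; ∃; _×_; _,_)
open import Data.Sum using (_⊎_)
open import Data.Empty using (⊥)
open import Relation.Nullary using (¬_)
open import Relation.Binary.PropositionalEquality using (_≡_; _≢_)
open import Data.Fin using (_≟_)
open import Relation.Nullary.Decidable using (⌊_⌋)

record Graph (n : ℕ) : Set where
  field
    adj    : Fin n → Fin n → Bool
    sym    : ∀ u v → adj u v ≡ adj v u
    irrefl : ∀ v → adj v v ≡ false
open Graph public

countB : {n : ℕ} → (Fin n → Bool) → ℕ
countB {n} p = length (filter (λ v → p v Data.Bool.≟ true) (allFin n))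

data Chain {n : ℕ} (G : Graph n) : List (Fin n) → Set where
  single : ∀ v → Chain G (v ∷ [])
  step   : ∀ u v vs → adj G u v ≡ true → Chain G (v ∷ vs) → Chain G (u ∷ v ∷ vs)

lastOr : {A : Set} → A → List A → A
lastOr d [] = d
lastOr d (x ∷ []) = x
lastOr d (x ∷ y ∷ xs) = lastOr d (y ∷ xs)

Path : {n : ℕ} → Graph n → Fin n → Fin n → Set
Path {n} G u v = Σ (List (Fin n)) λ vs → Σ (List (Fin n)) λ rest →
  (vs ≡ u ∷ rest) × (lastOr u vs ≡ v) × Chain G vs × Unique vs

Connected : {n : ℕ} → Graph n → Set
Connected G = ∀ u v → Path G u v

Cycle : {n : ℕ} → Graph n → Set
Cycle {n} G = Σ (Fin n) λ v₀ → Σ (List (Fin n)) λ rest →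
  (2 ≤ length rest) × Chain G (v₀ ∷ rest) × Unique (v₀ ∷ rest) ×
  (adj G (lastOr v₀ (v₀ ∷ rest)) v₀ ≡ true)

IsTree : {n : ℕ} → Graph n → Set
IsTree {n} G = (1 ≤ n) × Connected G × ¬ Cycle G

degree : {n : ℕ} → Graph n → Fin n → ℕ
degree G v = countB (adj G v)

isLeaf : {n : ℕ} → Graph n → Fin n → Bool
isLeaf G v = ⌊ degree G v Data.Nat.≟ 1 ⌋

numLeaves : {n : ℕ} → Graph n → ℕ
numLeaves G = countB (isLeaf G)

data Color : Set where
  red blue green : Color

PartialColoring : ℕ → Set
PartialColoring n = Fin n → Maybe Color

numColored : {n : ℕ} → PartialColoring n → ℕ
numColored c = countB (λ v → is-just (c v))

Proper : {n : ℕ} → Graph n → PartialColoring n → Set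
Proper G c = ∀ u v a → adj G u v ≡ true → c u ≡ just a → c v ≢ just a

Extends : {n : ℕ} → Graph n → PartialColoring n → Set
Extends {n} G c = Σ (Fin n → Color) λ f →
  (∀ v a → c v ≡ just a → f v ≡ a) ×
  (∀ u v → adj G u v ≡ true → f u ≢ f v)

erase : {n : ℕ} → Maybe (Fin n) → PartialColoring n → PartialColoring n
erase nothing  c = c
erase (just w) c v = if ⌊ v ≟ w ⌋ then nothing else c v

assign : {n : ℕ} → Fin n → Color → PartialColoring n → PartialColoring n
assign w a c v = if ⌊ v ≟ w ⌋ then just a else c v

-- SpoilerWins G k r c : Spoiler has a winning strategy in the r-round game
-- G^k_r on G started from the partial coloring c.
data SpoilerWins {n : ℕ} (G : Graph n) (k : ℕ) : ℕ → PartialColoring n → Set where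
  improper : ∀ {r c} → ¬ Proper G c → SpoilerWins G k r c
  move     : ∀ {r c} (e : Maybe (Fin n)) (w : Fin n) →
             erase e c w ≡ nothing →
             numColored (assign w red (erase e c)) ≤ k →
             (∀ a → SpoilerWins G k r (assign w a (erase e c))) →
             SpoilerWins G k (suc r) c

-- The uncoloured vertices of T are its inner vertices. As the leaf colouring does not extend, some
-- component K of them cannot be coloured compatibly with its coloured neighbours, its exits; every
-- vertex of K has degree at least 2. Acyclicity gives single attachment: a vertex outside a connected
-- set sees at most one of its vertices. Hence a component of K − v loses at least one exit of K and
-- gains only v, so K has at least three exits, all of them leaves, and |K| ≤ n − 3 < 2^r.
-- Spoiler colours a centroid v of K, first erasing, when the budget is used up, a coloured vertex
-- that is not an exit of K (there are fewer than k exits). Unless Duplicator's answer clashes at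
-- once, some component of K − v is again uncolourable, with at most half the vertices and no more
-- exits than K; after r rounds this region would be empty.

module Submission where

open import Defs
open import Data.Nat using (ℕ; zero; suc; _+_; _*_; _≤_; _<_; _^_; z≤n; s≤s; _<?_)
open import Data.Nat.Properties
  using (module ≤-Reasoning; ≤-trans; ≤-reflexive; <-≤-trans; ≤-<-trans; ≤-pred; n≤1+n; m≤m+n; m≤n+m;
         +-comm; +-suc; 1+n≰n; <⇒≤; ≮⇒≥; <-asym; +-monoˡ-≤; +-monoʳ-≤; +-monoʳ-<;
         +-cancelʳ-≤; +-cancelʳ-<; *-monoʳ-≤; *-cancelˡ-<; *-distribˡ-+; +-identityʳ)
import Data.Nat as ℕ
open import Data.Fin using (Fin; zero; suc; _≟_)
open import Data.Fin.Properties using (suc-injective; any?; all?)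
open import Data.Bool using (Bool; true; false; _∧_; _∨_; not; if_then_else_)
open import Data.Bool.Properties using (¬-not)
import Data.Bool.Properties as Bool
open import Data.Maybe using (Maybe; just; nothing; is-just; fromMaybe)
import Data.Maybe.Properties as Maybe
open import Data.List using (List; []; _∷_; length; filter; allFin; tabulate)
open import Data.List.Relation.Unary.All using (All; []; _∷_)
open import Data.List.Relation.Unary.All.Properties using (¬Any⇒All¬)
open import Data.List.Relation.Unary.Any using (here; there)
open import Data.List.Relation.Unary.AllPairs using ([]; _∷_)
open import Data.List.Relation.Unary.Unique.Propositional using (Unique)
open import Data.List.Membership.Propositional using (_∈_)
open import Data.List.Membership.Propositional.Properties using (∈-allFin)
import Data.List.Membership.DecPropositional as DecMembership
open import Data.Product using (Σ; ∃; _×_; _,_; proj₁; proj₂)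
open import Data.Sum using (_⊎_; inj₁; inj₂)
open import Data.Empty using (⊥; ⊥-elim)
open import Function using (_∘_)
open import Relation.Nullary using (¬_; Dec; yes; no; contradiction)
open import Relation.Nullary.Decidable using (⌊_⌋; decidable-stable; _×-dec_; _→-dec_; ¬?)
open import Relation.Binary.PropositionalEquality
  using (_≡_; _≢_; refl; trans; cong; subst) renaming (sym to ≡-sym)

variable
  n : ℕ

∧-trueˡ : ∀ {a b} → a ∧ b ≡ true → a ≡ true
∧-trueˡ {true} _ = refl

∧-trueʳ : ∀ {a b} → a ∧ b ≡ true → b ≡ true
∧-trueʳ {true} p = p

∧-true : ∀ {a b} → a ≡ true → b ≡ true → a ∧ b ≡ true
∧-true refl refl = refl

∨-true-elim : ∀ {a b} → a ∨ b ≡ true → (a ≡ true) ⊎ (b ≡ true)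
∨-true-elim {true} _ = inj₁ refl
∨-true-elim {false} p = inj₂ p

∨-trueˡ : ∀ {a b} → a ≡ true → a ∨ b ≡ true
∨-trueˡ refl = refl

∨-trueʳ : ∀ {a b} → b ≡ true → a ∨ b ≡ true
∨-trueʳ {true} _ = refl
∨-trueʳ {false} p = p

not-true : ∀ {a} → not a ≡ true → a ≡ false
not-true {false} _ = refl

not-false : ∀ {a} → a ≡ false → not a ≡ true
not-false refl = refl

true≢false : ∀ {a} → a ≡ true → a ≡ false → ⊥
true≢false refl ()

≢true⇒false : ∀ {a} → a ≢ true → a ≡ false
≢true⇒false = ¬-not {y = true}

bool-cases : (a : Bool) → (a ≡ true) ⊎ (a ≡ false)
bool-cases true = inj₁ refl
bool-cases false = inj₂ refl

_==_ : Fin n → Fin n → Bool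
x == y = ⌊ x ≟ y ⌋

==⇒≡ : {x y : Fin n} → x == y ≡ true → x ≡ y
==⇒≡ {x = x} {y} p with x ≟ y
... | yes q = q

==⇒≢ : {x y : Fin n} → x == y ≡ false → x ≢ y
==⇒≢ {x = x} {y} p with x ≟ y
... | no q = q

==-refl : (x : Fin n) → x == x ≡ true
==-refl x with x ≟ x
... | yes _ = refl
... | no q = ⊥-elim (q refl)

≢⇒== : {x y : Fin n} → x ≢ y → x == y ≡ false
≢⇒== {x = x} {y} q with x ≟ y
... | yes p = ⊥-elim (q p)
... | no _ = refl

VSet : ℕ → Set
VSet n = Fin n → Bool

_⊆ᵇ_ : VSet n → VSet n → Set
P ⊆ᵇ Q = ∀ x → P x ≡ true → Q x ≡ true

count : VSet n → ℕ
count {zero} P = 0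
count {suc n} P = (if P zero then 1 else 0) + count (P ∘ suc)

count-mono : (P Q : VSet n) → P ⊆ᵇ Q → count P ≤ count Q
count-mono {zero} P Q h = z≤n
count-mono {suc n} P Q h with P zero in e
... | true rewrite h zero e = s≤s (count-mono _ _ (h ∘ suc))
... | false = ≤-trans (count-mono (P ∘ suc) _ (h ∘ suc)) (m≤n+m _ _)

count-< : (P Q : VSet n) → P ⊆ᵇ Q → (x : Fin n) → Q x ≡ true → P x ≡ false → count P < count Q
count-< {suc n} P Q h zero qx px rewrite qx | px = s≤s (count-mono _ _ (h ∘ suc))
count-< {suc n} P Q h (suc x) qx px with P zero in e
... | true rewrite h zero e = s≤s (count-< _ _ (h ∘ suc) x qx px)
... | false = ≤-trans (count-< (P ∘ suc) _ (h ∘ suc) x qx px) (m≤n+m _ _)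

count-≤-except : (P Q : VSet n) (w : Fin n) → (∀ x → x ≢ w → P x ≡ true → Q x ≡ true) →
                 count P ≤ count Q + 1
count-≤-except {suc n} P Q zero h with P zero | Q zero
... | true  | true  = s≤s (≤-trans (count-mono _ _ (λ x → h (suc x) λ ())) (m≤m+n _ 1))
... | true  | false = ≤-trans (s≤s (count-mono _ _ (λ x → h (suc x) λ ()))) (≤-reflexive (+-comm 1 _))
... | false | true  = ≤-trans (count-mono _ _ (λ x → h (suc x) λ ())) (≤-trans (m≤m+n _ 1) (n≤1+n _))
... | false | false = ≤-trans (count-mono _ _ (λ x → h (suc x) λ ())) (m≤m+n _ 1)
count-≤-except {suc n} P Q (suc w) h
  with P zero in p0 | Q zero in q0 | count-≤-except (P ∘ suc) (Q ∘ suc) w (λ x x≢w → h (suc x) (x≢w ∘ suc-injective))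
... | true  | true  | ih = s≤s ih
... | true  | false | _  = ⊥-elim (true≢false (h zero (λ ()) p0) q0)
... | false | true  | ih = ≤-trans ih (m≤n+m _ 1)
... | false | false | ih = ih

count≤n : (P : VSet n) → count P ≤ n
count≤n {zero} P = z≤n
count≤n {suc n} P with P zero
... | true = s≤s (count≤n _)
... | false = ≤-trans (count≤n _) (n≤1+n _)

count-pos : (P : VSet n) (x : Fin n) → P x ≡ true → 1 ≤ count P
count-pos P x px = ≤-trans (s≤s z≤n) (count-< (λ _ → false) P (λ _ ()) x px refl)

count-∅ : ∀ n → count {n} (λ _ → false) ≡ 0
count-∅ zero = refl
count-∅ (suc n) = count-∅ n

count-cong : (P Q : VSet n) → (∀ x → P x ≡ Q x) → count P ≡ count Q
count-cong {zero} P Q h = refl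
count-cong {suc n} P Q h rewrite h zero = cong (_ +_) (count-cong _ _ (h ∘ suc))

count-disjoint : (P Q R : VSet n) → P ⊆ᵇ R → Q ⊆ᵇ R → (∀ x → P x ≡ true → Q x ≡ false) →
                 count P + count Q ≤ count R
count-disjoint {zero} P Q R _ _ _ = z≤n
count-disjoint {suc n} P Q R hP hQ hPQ with P zero in p0 | Q zero in q0
... | true  | true  = ⊥-elim (true≢false q0 (hPQ zero p0))
... | true  | false rewrite hP zero p0 = s≤s (count-disjoint _ _ _ (hP ∘ suc) (hQ ∘ suc) (hPQ ∘ suc))
... | false | true  rewrite hQ zero q0 =
  ≤-trans (≤-reflexive (+-suc _ _)) (s≤s (count-disjoint _ _ _ (hP ∘ suc) (hQ ∘ suc) (hPQ ∘ suc)))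
... | false | false = ≤-trans (count-disjoint _ _ _ (hP ∘ suc) (hQ ∘ suc) (hPQ ∘ suc)) (m≤n+m _ _)

count-complement : (P : VSet n) → count P + count (not ∘ P) ≡ n
count-complement {zero} P = refl
count-complement {suc n} P with P zero
... | true = cong suc (count-complement _)
... | false = trans (+-suc _ _) (cong suc (count-complement _))

countB≡count : (P : VSet n) → countB P ≡ count P
countB≡count P = go P (λ i → i)
  where
  go : ∀ {m} (P : VSet n) (f : Fin m → Fin n) →
       length (filter (λ v → P v Bool.≟ true) (tabulate f)) ≡ count (P ∘ f)
  go {m = zero} P f = refl
  go {m = suc m} P f with P (f zero)
  ... | true = cong suc (go P (f ∘ suc))
  ... | false = go P (f ∘ suc)

find : (P : VSet n) → (∃ λ x → P x ≡ true) ⊎ (∀ x → P x ≡ false)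
find P with any? (λ x → P x Bool.≟ true)
... | yes w = inj₁ w
... | no none = inj₂ λ x → ≢true⇒false λ px → none (x , px)

anyᵇ : VSet n → Bool
anyᵇ P = ⌊ any? (λ x → P x Bool.≟ true) ⌋

anyᵇ-elim : (P : VSet n) → anyᵇ P ≡ true → ∃ λ x → P x ≡ true
anyᵇ-elim P h with any? (λ x → P x Bool.≟ true)
... | yes w = w

anyᵇ-intro : (P : VSet n) (x : Fin n) → P x ≡ true → anyᵇ P ≡ true
anyᵇ-intro P x px with any? (λ x → P x Bool.≟ true)
... | yes _ = refl
... | no none = ⊥-elim (none (x , px))

_∖_ : VSet n → Fin n → VSet n
(P ∖ v) x = P x ∧ not (x == v)

∖-intro : (P : VSet n) (v : Fin n) {x : Fin n} → P x ≡ true → x ≢ v → (P ∖ v) x ≡ true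
∖-intro P v px x≢v rewrite px | ≢⇒== x≢v = refl

∖-⊆ : (P : VSet n) (v : Fin n) → (P ∖ v) ⊆ᵇ P
∖-⊆ P v x = ∧-trueˡ

∖-≢ : (P : VSet n) (v : Fin n) {x : Fin n} → (P ∖ v) x ≡ true → x ≢ v
∖-≢ P v {x} h = ==⇒≢ (not-true (∧-trueʳ {P x} h))

∖-self : (P : VSet n) (v : Fin n) → (P ∖ v) v ≡ false
∖-self P v rewrite ==-refl v with P v
... | true = refl
... | false = refl

count-∖ : (P : VSet n) (v : Fin n) → P v ≡ true → count (P ∖ v) < count P
count-∖ P v pv = count-< (P ∖ v) P (∖-⊆ P v) v pv (∖-self P v)

two-members : (P : VSet n) → 2 ≤ count P →
              Σ (Fin n) λ a → Σ (Fin n) λ b → a ≢ b × P a ≡ true × P b ≡ true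
two-members {n} P h with find P
... | inj₂ none = contradiction (≤-trans h (≤-trans (count-mono P (λ _ → false) empty) (≤-reflexive (count-∅ n)))) λ ()
  where
  empty : P ⊆ᵇ (λ _ → false)
  empty x px = ⊥-elim (true≢false px (none x))
... | inj₁ (a , pa) with find (P ∖ a)
... | inj₁ (b , q) = a , b , (λ e → ∖-≢ P a q (≡-sym e)) , pa , ∖-⊆ P a b q
... | inj₂ none = ⊥-elim (1+n≰n (≤-trans h (≤-trans (count-≤-except P (λ _ → false) a only-a)
                                                     (≤-reflexive (cong (_+ 1) (count-∅ n))))))
  where
  only-a : ∀ x → x ≢ a → P x ≡ true → false ≡ true
  only-a x x≢a px = ⊥-elim (true≢false (∖-intro P a px x≢a) (none x))

three-members : (P : VSet n) (a b c : Fin n) → a ≢ b → a ≢ c → b ≢ c →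
                P a ≡ true → P b ≡ true → P c ≡ true → 3 ≤ count P
three-members P a b c a≢b a≢c b≢c pa pb pc =
  ≤-trans (s≤s (≤-trans (s≤s (≤-trans (s≤s z≤n) (count-∖ _ c pc″))) (count-∖ _ b pb′))) (count-∖ P a pa)
  where
  pb′ = ∖-intro P a pb (a≢b ∘ ≡-sym)
  pc″ = ∖-intro (P ∖ a) b (∖-intro P a pc (a≢c ∘ ≡-sym)) (b≢c ∘ ≡-sym)

module Components {n : ℕ} (G : Graph n) where

  private
    grow : VSet n → VSet n → VSet n
    grow S R y = R y ∨ (S y ∧ anyᵇ (λ x → R x ∧ adj G x y))

    reach : VSet n → Fin n → ℕ → VSet n
    reach S a zero y = y == a
    reach S a (suc m) = grow S (reach S a m)

    module _ (S : VSet n) (a : Fin n) where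

      reach-root : ∀ m → reach S a m a ≡ true
      reach-root zero = ==-refl a
      reach-root (suc m) = ∨-trueˡ (reach-root m)

      reach-step : ∀ m x y → reach S a m x ≡ true → S y ≡ true → adj G x y ≡ true →
                   reach S a (suc m) y ≡ true
      reach-step m x y rx sy axy =
        ∨-trueʳ {reach S a m y} (∧-true sy (anyᵇ-intro (λ x → reach S a m x ∧ adj G x y) x (∧-true rx axy)))

      reach-ind : (P : Fin n → Set) → P a → (∀ x y → P x → S y ≡ true → adj G x y ≡ true → P y) →
                  ∀ m y → reach S a m y ≡ true → P y
      reach-ind P pa closed zero y h = subst P (≡-sym (==⇒≡ h)) pa
      reach-ind P pa closed (suc m) y h with ∨-true-elim {reach S a m y} h
      ... | inj₁ old = reach-ind P pa closed m y old
      ... | inj₂ new with anyᵇ-elim (λ x → reach S a m x ∧ adj G x y) (∧-trueʳ {S y} new)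
      ... | x , q = closed x y (reach-ind P pa closed m x (∧-trueˡ q)) (∧-trueˡ new) (∧-trueʳ {reach S a m x} q)

      reach-stable-step : ∀ m → reach S a (suc m) ⊆ᵇ reach S a m →
                          reach S a (suc (suc m)) ⊆ᵇ reach S a (suc m)
      reach-stable-step m stable y h with ∨-true-elim {reach S a (suc m) y} h
      ... | inj₁ old = old
      ... | inj₂ new with anyᵇ-elim (λ x → reach S a (suc m) x ∧ adj G x y) (∧-trueʳ {S y} new)
      ... | x , q = reach-step m x y (stable x (∧-trueˡ q)) (∧-trueˡ new) (∧-trueʳ {reach S a (suc m) x} q)

      reach-stable-or-large : ∀ m → (reach S a (suc m) ⊆ᵇ reach S a m) ⊎ (suc m ≤ count (reach S a m))
      reach-stable-or-large zero = inj₂ (count-pos _ a (reach-root zero))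
      reach-stable-or-large (suc m) with find (λ y → reach S a (suc m) y ∧ not (reach S a m y))
      ... | inj₂ none = inj₁ (reach-stable-step m stable)
        where
        stable : reach S a (suc m) ⊆ᵇ reach S a m
        stable y h with bool-cases (reach S a m y)
        ... | inj₁ old = old
        ... | inj₂ e = ⊥-elim (true≢false (∧-true h (not-false e)) (none y))
      ... | inj₁ (y , new) with reach-stable-or-large m
      ... | inj₁ stable = ⊥-elim (true≢false (stable y (∧-trueˡ new)) (not-true (∧-trueʳ {reach S a (suc m) y} new)))
      ... | inj₂ large = inj₂ (≤-trans (s≤s large)
            (count-< (reach S a m) _ (λ _ → ∨-trueˡ) y (∧-trueˡ new) (not-true (∧-trueʳ {reach S a (suc m) y} new))))

    reach-closed : (S : VSet n) (a : Fin n) → reach S a (suc n) ⊆ᵇ reach S a n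
    reach-closed S a with reach-stable-or-large S a n
    ... | inj₁ stable = stable
    ... | inj₂ large = ⊥-elim (1+n≰n (≤-trans large (count≤n _)))

  -- The vertices reachable from a by edges into S; it contains a even when a ∉ S.
  component : VSet n → Fin n → VSet n
  component S a = reach S a n

  component-root : (S : VSet n) (a : Fin n) → component S a a ≡ true
  component-root S a = reach-root S a n

  component-step : (S : VSet n) (a x y : Fin n) → component S a x ≡ true → S y ≡ true →
                   adj G x y ≡ true → component S a y ≡ true
  component-step S a x y cx sy axy = reach-closed S a y (reach-step S a n x y cx sy axy)

  component-ind : (S : VSet n) (a : Fin n) (P : Fin n → Set) → P a →
                  (∀ x y → P x → S y ≡ true → adj G x y ≡ true → P y) →
                  ∀ y → component S a y ≡ true → P y
  component-ind S a P pa closed = reach-ind S a P pa closed n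

  component-⊆ : (S : VSet n) (a : Fin n) → S a ≡ true → component S a ⊆ᵇ S
  component-⊆ S a sa = component-ind S a (λ y → S y ≡ true) sa (λ _ _ _ sy _ → sy)

  component-trans : (S : VSet n) (a b c : Fin n) →
                    component S a b ≡ true → component S b c ≡ true → component S a c ≡ true
  component-trans S a b c ab =
    component-ind S b (λ z → component S a z ≡ true) ab (λ x y → component-step S a x y) c

  component-sym : (S : VSet n) (a b : Fin n) → S a ≡ true →
                  component S a b ≡ true → component S b a ≡ true
  component-sym S a b sa ab = proj₂ (component-ind S a P (sa , component-root S a) closed b ab)
    where
    P : Fin n → Set
    P y = S y ≡ true × component S y a ≡ true
    closed : ∀ x y → P x → S y ≡ true → adj G x y ≡ true → P y
    closed x y (sx , xa) sy axy =
      sy , component-trans S y x a (component-step S y y x (component-root S y) sx (trans (sym G y x) axy)) xa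

  component-mono : (S T : VSet n) (a : Fin n) → component S a ⊆ᵇ T → component S a ⊆ᵇ component T a
  component-mono S T a S⊆T z cz = proj₂ (component-ind S a P (component-root S a , component-root T a) closed z cz)
    where
    P : Fin n → Set
    P y = component S a y ≡ true × component T a y ≡ true
    closed : ∀ x y → P x → S y ≡ true → adj G x y ≡ true → P y
    closed x y (sx , tx) sy axy = let sy′ = component-step S a x y sx sy axy in
      sy′ , component-step T a x y tx (S⊆T y sy′) axy

  IsConnected : VSet n → Set
  IsConnected K = ∀ x y → K x ≡ true → K y ≡ true → component K x y ≡ true

  component-connected : (S : VSet n) (a : Fin n) → S a ≡ true → IsConnected (component S a)
  component-connected S a sa x y ax ay =
    component-mono S (component S a) x (λ z xz → component-trans S a x z ax xz) y
      (component-trans S x a y (component-sym S a x sa ax) ay)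

  boundary : VSet n → VSet n
  boundary K y = not (K y) ∧ anyᵇ (λ x → K x ∧ adj G x y)

  boundary-intro : (K : VSet n) (x y : Fin n) → K y ≡ false → K x ≡ true → adj G x y ≡ true → boundary K y ≡ true
  boundary-intro K x y ky kx axy rewrite ky = anyᵇ-intro (λ x → K x ∧ adj G x y) x (∧-true kx axy)

  boundary-elim : (K : VSet n) (y : Fin n) → boundary K y ≡ true →
                  K y ≡ false × ∃ λ x → K x ≡ true × adj G x y ≡ true
  boundary-elim K y h with anyᵇ-elim (λ x → K x ∧ adj G x y) (∧-trueʳ {not (K y)} h)
  ... | x , q = not-true (∧-trueˡ h) , x , ∧-trueˡ q , ∧-trueʳ {K x} q

  Branching : VSet n → Set
  Branching K = ∀ x → K x ≡ true → Σ (Fin n) λ y₁ → Σ (Fin n) λ y₂ → y₁ ≢ y₂ × adj G x y₁ ≡ true × adj G x y₂ ≡ true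

  adj⇒≢ : (x y : Fin n) → adj G x y ≡ true → x ≢ y
  adj⇒≢ x .x h refl = true≢false h (irrefl G x)

  component-meets-neighbour : (K : VSet n) (v z : Fin n) → IsConnected K → K v ≡ true → (K ∖ v) z ≡ true →
                              ∃ λ y → component (K ∖ v) z y ≡ true × adj G v y ≡ true
  component-meets-neighbour K v z K-conn kv sz
    with component-ind K z P (inj₁ (component-root S z)) closed v (K-conn z v (∖-⊆ K v z sz) kv)
    where
    S = K ∖ v
    P : Fin n → Set
    P q = component S z q ≡ true ⊎ ∃ λ y → component S z y ≡ true × adj G v y ≡ true
    closed : ∀ q w → P q → K w ≡ true → adj G q w ≡ true → P w
    closed q w (inj₂ found) _ _ = inj₂ found
    closed q w (inj₁ zq) kw aqw with w ≟ v
    ... | yes refl = inj₂ (q , zq , trans (sym G v q) aqw)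
    ... | no w≢v = inj₁ (component-step S z q w zq (∖-intro K v kw w≢v) aqw)
  ... | inj₂ found = found
  ... | inj₁ zv = ⊥-elim (true≢false (component-⊆ (K ∖ v) z sz v zv) (∖-self K v))

  non-leaf-branching : (x : Fin n) → isLeaf G x ≡ false → (∃ λ y → adj G x y ≡ true) →
                       Σ (Fin n) λ y₁ → Σ (Fin n) λ y₂ → y₁ ≢ y₂ × adj G x y₁ ≡ true × adj G x y₂ ≡ true
  non-leaf-branching x ¬leaf (y , axy) = by-degree (count (adj G x)) refl
    where
    by-degree : ∀ d → count (adj G x) ≡ d →
                Σ (Fin n) λ y₁ → Σ (Fin n) λ y₂ → y₁ ≢ y₂ × adj G x y₁ ≡ true × adj G x y₂ ≡ true
    by-degree zero deg≡0 = ⊥-elim (1+n≰n (≤-trans (count-pos (adj G x) y axy) (≤-reflexive deg≡0)))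
    by-degree (suc zero) deg≡1 with subst (λ d → ⌊ d ℕ.≟ 1 ⌋ ≡ false) (trans (countB≡count (adj G x)) deg≡1) ¬leaf
    ... | ()
    by-degree (suc (suc d)) deg≡2+d = two-members (adj G x) (≤-trans (s≤s (s≤s z≤n)) (≤-reflexive (≡-sym deg≡2+d)))

lastOr-irrelevant : {A : Set} (d d′ x : A) (xs : List A) → lastOr d (x ∷ xs) ≡ lastOr d′ (x ∷ xs)
lastOr-irrelevant d d′ x [] = refl
lastOr-irrelevant d d′ x (y ∷ xs) = lastOr-irrelevant d d′ y xs

module Paths {n : ℕ} (G : Graph n) where
  open Components G
  open DecMembership (_≟_ {n}) using (_∈?_)

  record PathIn (S : VSet n) (y u : Fin n) : Set where
    field
      rest   : List (Fin n)
      ends   : lastOr y (y ∷ rest) ≡ u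
      chain  : Chain G (y ∷ rest)
      unique : Unique (y ∷ rest)
      inside : All (λ w → S w ≡ true) (y ∷ rest)
  open PathIn

  suffix : ∀ {S x y u} (p : PathIn S x u) → y ∈ (x ∷ rest p) → PathIn S y u
  suffix p (here refl) = p
  suffix {x = x} record { rest = x′ ∷ xs ; ends = e ; chain = step _ _ _ _ ch ; unique = _ ∷ un ; inside = _ ∷ al }
         (there y∈) =
    suffix record { rest = xs ; ends = trans (lastOr-irrelevant x′ x x′ xs) e
                  ; chain = ch ; unique = un ; inside = al } y∈

  extend : ∀ {S x y u} → PathIn S x u → S y ≡ true → adj G x y ≡ true → PathIn S y u
  extend {x = x} {y} p sy axy with y ∈? (x ∷ rest p)
  ... | yes y∈ = suffix p y∈
  ... | no y∉ = record
    { rest = x ∷ rest p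
    ; ends = trans (lastOr-irrelevant y x x (rest p)) (ends p)
    ; chain = step y x (rest p) (trans (sym G y x) axy) (chain p)
    ; unique = ¬Any⇒All¬ (x ∷ rest p) y∉ ∷ unique p
    ; inside = sy ∷ inside p }

  component⇒path : (S : VSet n) (u z : Fin n) → S u ≡ true → component S u z ≡ true → PathIn S z u
  component⇒path S u z su = component-ind S u (λ z → PathIn S z u) trivial (λ _ _ p sy axy → extend p sy axy) z
    where
    trivial : PathIn S u u
    trivial = record { rest = [] ; ends = refl ; chain = single u ; unique = [] ∷ [] ; inside = su ∷ [] }

  outside-≢ : (S : VSet n) (v : Fin n) (xs : List (Fin n)) → S v ≡ false → All (λ w → S w ≡ true) xs → All (v ≢_) xs
  outside-≢ S v [] sv [] = []
  outside-≢ S v (w ∷ xs) sv (sw ∷ al) = (λ { refl → true≢false sw sv }) ∷ outside-≢ S v xs sv al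

  -- Two neighbours u, z of v in one component of S ∌ v close up, with the path from z to u, a cycle through v.
  single-attachment : ¬ Cycle G → (S : VSet n) (u z v : Fin n) → S u ≡ true → S v ≡ false →
                      component S u z ≡ true → adj G v u ≡ true → adj G v z ≡ true → u ≡ z
  single-attachment acyclic S u z v su sv uz avu avz with component⇒path S u z su uz
  ... | record { rest = [] ; ends = e } = ≡-sym e
  ... | record { rest = w ∷ ws ; ends = e ; chain = ch ; unique = un ; inside = al } =
    ⊥-elim (acyclic (v , z ∷ w ∷ ws , s≤s (s≤s z≤n) , step v z (w ∷ ws) avz ch ,
                     outside-≢ S v (z ∷ w ∷ ws) sv al ∷ un , closing))
    where
    closing : adj G (lastOr v (z ∷ w ∷ ws)) v ≡ true
    closing = subst (λ q → adj G q v ≡ true) (≡-sym (trans (lastOr-irrelevant v z z (w ∷ ws)) e))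
                    (trans (sym G u v) avu)

_≟ᶜ_ : (a b : Color) → Dec (a ≡ b)
red   ≟ᶜ red   = yes refl
red   ≟ᶜ blue  = no λ ()
red   ≟ᶜ green = no λ ()
blue  ≟ᶜ red   = no λ ()
blue  ≟ᶜ blue  = yes refl
blue  ≟ᶜ green = no λ ()
green ≟ᶜ red   = no λ ()
green ≟ᶜ blue  = no λ ()
green ≟ᶜ green = yes refl

_∷ᶜ_ : Color → (Fin n → Color) → Fin (suc n) → Color
(a ∷ᶜ g) zero = a
(a ∷ᶜ g) (suc i) = g i

∃-coloring? : ∀ n (P : (Fin n → Color) → Set) → (∀ f → Dec (P f)) →
              (∀ f g → (∀ i → f i ≡ g i) → P f → P g) → Dec (Σ (Fin n → Color) P)
∃-coloring? zero P P? resp with P? (λ ())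
... | yes p = yes (_ , p)
... | no ¬p = no λ (f , pf) → ¬p (resp f _ (λ ()) pf)
∃-coloring? (suc n) P P? resp with with-head red | with-head blue | with-head green
  where
  with-head : ∀ a → Dec (Σ (Fin n → Color) λ g → P (a ∷ᶜ g))
  with-head a = ∃-coloring? n (λ g → P (a ∷ᶜ g)) (λ g → P? _)
                  (λ g g′ e → resp _ _ λ { zero → refl ; (suc i) → e i })
... | yes (g , p) | _ | _ = yes (_ , p)
... | no _ | yes (g , p) | _ = yes (_ , p)
... | no _ | no _ | yes (g , p) = yes (_ , p)
... | no ¬r | no ¬b | no ¬g = no λ (f , pf) → by-head f (resp f _ (λ { zero → refl ; (suc i) → refl }) pf)
  where
  by-head : (f : Fin (suc n) → Color) → P (f zero ∷ᶜ (f ∘ suc)) → ⊥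
  by-head f p with f zero
  ... | red = ¬r (_ , p)
  ... | blue = ¬b (_ , p)
  ... | green = ¬g (_ , p)

just≢nothing : {A : Set} {a : A} → just a ≢ nothing
just≢nothing ()

_≟ᵐ_ : (m m′ : Maybe Color) → Dec (m ≡ m′)
_≟ᵐ_ = Maybe.≡-dec _≟ᶜ_

all-colors? : {P : Color → Set} → (∀ a → Dec (P a)) → Dec (∀ a → P a)
all-colors? P? with P? red | P? blue | P? green
... | yes r | yes b | yes g = yes λ { red → r ; blue → b ; green → g }
... | no ¬r | _ | _ = no λ h → ¬r (h red)
... | yes _ | no ¬b | _ = no λ h → ¬b (h blue)
... | yes _ | yes _ | no ¬g = no λ h → ¬g (h green)

is-just-elim : (m : Maybe Color) → is-just m ≡ true → ∃ λ b → m ≡ just b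
is-just-elim (just b) _ = b , refl

colored : PartialColoring n → VSet n
colored c y = is-just (c y)

blank : PartialColoring n → VSet n
blank c y = not (is-just (c y))

numColored≡count : (c : PartialColoring n) → numColored c ≡ count (colored c)
numColored≡count c = countB≡count (colored c)

assign-self : (w : Fin n) (a : Color) (c : PartialColoring n) → assign w a c w ≡ just a
assign-self w a c rewrite ==-refl w = refl

assign-other : {w v : Fin n} (a : Color) (c : PartialColoring n) → v ≢ w → assign w a c v ≡ c v
assign-other a c v≢w rewrite ≢⇒== v≢w = refl

erase-self : (e : Fin n) (c : PartialColoring n) → erase (just e) c e ≡ nothing
erase-self e c rewrite ==-refl e = refl

erase-other : {e v : Fin n} (c : PartialColoring n) → v ≢ e → erase (just e) c v ≡ c v
erase-other c v≢e rewrite ≢⇒== v≢e = refl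

count-colored-assign : (c : PartialColoring n) (v : Fin n) (a : Color) →
                       count (colored (assign v a c)) ≤ count (colored c) + 1
count-colored-assign c v a = count-≤-except _ _ v λ x x≢v h → trans (cong is-just (≡-sym (assign-other a c x≢v))) h

proper? : (G : Graph n) (c : PartialColoring n) → Dec (Proper G c)
proper? G c = all? λ u → all? λ v → all-colors? λ a →
  (adj G u v Bool.≟ true) →-dec (c u ≟ᵐ just a) →-dec ¬? (c v ≟ᵐ just a)

module Colorings {n : ℕ} (G : Graph n) where
  open Components G

  ColorsAt : VSet n → PartialColoring n → (Fin n → Color) → Set
  ColorsAt K c f = ∀ x y → K x ≡ true → adj G x y ≡ true → (f x ≢ f y) × (∀ a → c y ≡ just a → f y ≡ a)

  Colorable : VSet n → PartialColoring n → Set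
  Colorable K c = Σ (Fin n → Color) (ColorsAt K c)

  colorable? : (K : VSet n) (c : PartialColoring n) → Dec (Colorable K c)
  colorable? K c = ∃-coloring? n (ColorsAt K c) colorsAt? resp
    where
    agrees? : (m : Maybe Color) (b : Color) → Dec (∀ a → m ≡ just a → b ≡ a)
    agrees? nothing b = yes λ a ()
    agrees? (just a′) b with b ≟ᶜ a′
    ... | yes p = yes λ { a refl → p }
    ... | no ¬p = no λ h → ¬p (h a′ refl)
    colorsAt? : ∀ f → Dec (ColorsAt K c f)
    colorsAt? f = all? λ x → all? λ y →
      (K x Bool.≟ true) →-dec (adj G x y Bool.≟ true) →-dec (¬? (f x ≟ᶜ f y) ×-dec agrees? (c y) (f y))
    resp : ∀ f g → (∀ i → f i ≡ g i) → ColorsAt K c f → ColorsAt K c g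
    resp f g f≗g hf x y kx axy rewrite ≡-sym (f≗g x) | ≡-sym (f≗g y) = hf x y kx axy

  ColorsAt-⊆ : ∀ {K K′ c f} → K ⊆ᵇ K′ → ColorsAt K′ c f → ColorsAt K c f
  ColorsAt-⊆ K⊆K′ hf x y kx = hf x y (K⊆K′ x kx)

  ColorsAt-transfer : ∀ {K c} (f g : Fin n → Color) → ColorsAt K c g → ∀ x y → K x ≡ true → adj G x y ≡ true →
                      f x ≡ g x → f y ≡ g y → (f x ≢ f y) × (∀ a → c y ≡ just a → f y ≡ a)
  ColorsAt-transfer f g hg x y kx axy fx fy rewrite fx | fy = hg x y kx axy

  ClosedIn : VSet n → VSet n → Set
  ClosedIn S U = ∀ x y → U x ≡ true → S y ≡ true → adj G x y ≡ true → U y ≡ true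

  -- The regions of S are coloured independently, because every edge leaving S ends at a coloured vertex.
  module _ (S : VSet n) (c : PartialColoring n)
           (exits-colored : ∀ x y → S x ≡ true → adj G x y ≡ true → S y ≡ false → ∃ λ b → c y ≡ just b) where

    colorable-∪ : (U C : VSet n) → U ⊆ᵇ S → ClosedIn S U → C ⊆ᵇ S → ClosedIn S C →
                  (∀ z → C z ≡ true → U z ≡ false) → Colorable U c → Colorable C c →
                  Colorable (λ y → U y ∨ C y) c
    colorable-∪ U C U⊆S U-closed C⊆S C-closed disjoint (fU , hU) (fC , hC) = f , colors
      where
      f : Fin n → Color
      f y = if C y then fC y else (if U y then fU y else fromMaybe red (c y))

      outside : ∀ {K} → K ⊆ᵇ S → ∀ y → S y ≡ false → K y ≡ false
      outside K⊆S y sy = ≢true⇒false λ ky → true≢false (K⊆S y ky) sy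

      escapes : ∀ {K} → ClosedIn S K → ∀ x y → K x ≡ true → adj G x y ≡ true → K y ≡ false → S y ≡ false
      escapes K-closed x y kx axy ky = ≢true⇒false λ sy → true≢false (K-closed x y kx sy axy) ky

      f-at-exit : ∀ {K} g → K ⊆ᵇ S → ColorsAt K c g → ∀ x y → K x ≡ true → adj G x y ≡ true →
                  S y ≡ false → f y ≡ g y
      f-at-exit g K⊆S hg x y kx axy sy with exits-colored x y (K⊆S x kx) axy sy
      ... | b , cy rewrite outside C⊆S y sy | outside U⊆S y sy | cy = ≡-sym (proj₂ (hg x y kx axy) b cy)

      f-on-C : ∀ y → C y ≡ true → f y ≡ fC y
      f-on-C y cy rewrite cy = refl

      f-on-U : ∀ y → C y ≡ false → U y ≡ true → f y ≡ fU y
      f-on-U y cy uy rewrite cy | uy = refl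

      colors : ColorsAt (λ y → U y ∨ C y) c f
      colors x y hx axy with bool-cases (C x)
      ... | inj₁ cx = ColorsAt-transfer f fC hC x y cx axy (f-on-C x cx) f-y
        where
        f-y : f y ≡ fC y
        f-y with bool-cases (C y)
        ... | inj₁ cy = f-on-C y cy
        ... | inj₂ cy = f-at-exit fC C⊆S hC x y cx axy (escapes C-closed x y cx axy cy)
      ... | inj₂ cx = ColorsAt-transfer f fU hU x y ux axy (f-on-U x cx ux) f-y
        where
        ux : U x ≡ true
        ux with ∨-true-elim {U x} hx
        ... | inj₁ ux = ux
        ... | inj₂ cx′ = ⊥-elim (true≢false cx′ cx)
        f-y : f y ≡ fU y
        f-y with bool-cases (C y) | bool-cases (U y)
        ... | inj₁ cy | _ = ⊥-elim (true≢false (U-closed x y ux (C⊆S y cy) axy) (disjoint y cy))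
        ... | inj₂ cy | inj₁ uy = f-on-U y cy uy
        ... | inj₂ cy | inj₂ uy = f-at-exit fU U⊆S hU x y ux axy (escapes U-closed x y ux axy uy)

    colorable-from-components : (∀ x → S x ≡ true → Colorable (component S x) c) → Colorable S c
    colorable-from-components each with cover (allFin n)
      where
      Cover : List (Fin n) → Set
      Cover xs = Σ (VSet n) λ U → U ⊆ᵇ S × ClosedIn S U × Colorable U c × (∀ x → x ∈ xs → S x ≡ true → U x ≡ true)
      cover : (xs : List (Fin n)) → Cover xs
      cover [] = (λ _ → false) , (λ _ ()) , (λ _ _ ()) , ((λ _ → red) , λ _ _ ()) , λ _ ()
      cover (x ∷ xs) with cover xs
      ... | U , U⊆S , U-closed , colU , covers with bool-cases (S x) | bool-cases (U x)
      ...   | inj₂ sx | _ = U , U⊆S , U-closed , colU , covers′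
        where
        covers′ : ∀ y → y ∈ x ∷ xs → S y ≡ true → U y ≡ true
        covers′ y (here refl) sy = ⊥-elim (true≢false sy sx)
        covers′ y (there y∈) = covers y y∈
      ...   | inj₁ sx | inj₁ ux = U , U⊆S , U-closed , colU , covers′
        where
        covers′ : ∀ y → y ∈ x ∷ xs → S y ≡ true → U y ≡ true
        covers′ y (here refl) _ = ux
        covers′ y (there y∈) = covers y y∈
      ...   | inj₁ sx | inj₂ ux = U′ , U′⊆S , U′-closed ,
                                  colorable-∪ U C U⊆S U-closed C⊆S C-closed disjoint colU (each x sx) , covers′
        where
        C = component S x
        C⊆S = component-⊆ S x sx
        C-closed : ClosedIn S C
        C-closed = component-step S x
        disjoint : ∀ z → C z ≡ true → U z ≡ false
        disjoint z cz = ≢true⇒false λ uz →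
          true≢false (component-ind S z (λ w → U w ≡ true) uz U-closed x (component-sym S x z sx cz)) ux
        U′ : VSet n
        U′ y = U y ∨ C y
        U′⊆S : U′ ⊆ᵇ S
        U′⊆S y h with ∨-true-elim {U y} h
        ... | inj₁ uy = U⊆S y uy
        ... | inj₂ cy = C⊆S y cy
        U′-closed : ClosedIn S U′
        U′-closed a b h sb ab with ∨-true-elim {U a} h
        ... | inj₁ ua = ∨-trueˡ (U-closed a b ua sb ab)
        ... | inj₂ ca = ∨-trueʳ {U b} (C-closed a b ca sb ab)
        covers′ : ∀ y → y ∈ x ∷ xs → S y ≡ true → U′ y ≡ true
        covers′ y (here refl) _ = ∨-trueʳ {U y} (component-root S y)
        covers′ y (there y∈) sy = ∨-trueˡ (covers y y∈ sy)
    ... | U , _ , _ , (f , hf) , covers = f , ColorsAt-⊆ (λ x sx → covers x (∈-allFin x) sx) hf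

    colorable-or-bad-component : Colorable S c ⊎ (∃ λ x → S x ≡ true × ¬ Colorable (component S x) c)
    colorable-or-bad-component with any? (λ x → (S x Bool.≟ true) ×-dec ¬? (colorable? (component S x) c))
    ... | yes bad = inj₂ bad
    ... | no none = inj₁ (colorable-from-components λ x sx →
                            decidable-stable (colorable? (component S x) c) λ ¬col → none (x , sx , ¬col))

  isolated⇒colorable : ∀ {K c} x → IsConnected K → K x ≡ true → (∀ y → adj G x y ≡ false) → Colorable K c
  isolated⇒colorable {K} x K-conn kx lonely = (λ _ → red) , λ x′ y kx′ ax′y →
    ⊥-elim (true≢false (subst (λ q → adj G q y ≡ true) (only-x x′ kx′) ax′y) (lonely y))
    where
    only-x : ∀ x′ → K x′ ≡ true → x′ ≡ x
    only-x x′ kx′ = component-ind K x (λ q → q ≡ x) refl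
      (λ q w q≡x _ aqw → ⊥-elim (true≢false (subst (λ z → adj G z w ≡ true) q≡x aqw) (lonely w))) x′ (K-conn x x′ kx kx′)

  extends : (c : PartialColoring n) → Proper G c → Colorable (blank c) c → Extends G c
  extends c proper (f , hf) = F , (λ v a cv → cong (fromMaybe (f v)) cv) , F-proper
    where
    F : Fin n → Color
    F y = fromMaybe (f y) (c y)
    nothing⇒blank : ∀ y → c y ≡ nothing → blank c y ≡ true
    nothing⇒blank y cy rewrite cy = refl
    F-colored : ∀ y b → c y ≡ just b → F y ≡ b
    F-colored y b cy = cong (fromMaybe (f y)) cy
    F-blank : ∀ y → c y ≡ nothing → F y ≡ f y
    F-blank y cy = cong (fromMaybe (f y)) cy
    F-neighbour : ∀ x y → c x ≡ nothing → adj G x y ≡ true → ∀ m → c y ≡ m → F y ≡ f y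
    F-neighbour x y cx axy (just b) cy = trans (F-colored y b cy) (≡-sym (proj₂ (hf x y (nothing⇒blank x cx) axy) b cy))
    F-neighbour x y cx axy nothing cy = F-blank y cy
    F-proper : ∀ u v → adj G u v ≡ true → F u ≢ F v
    F-proper u v auv Fu≡Fv = by-cases (c u) (c v) refl refl
      where
      avu = trans (sym G v u) auv
      by-cases : ∀ mu mv → c u ≡ mu → c v ≡ mv → ⊥
      by-cases nothing _ cu _ = proj₁ (hf u v (nothing⇒blank u cu) auv)
        (trans (≡-sym (F-blank u cu)) (trans Fu≡Fv (F-neighbour u v cu auv (c v) refl)))
      by-cases (just a) nothing _ cv = proj₁ (hf v u (nothing⇒blank v cv) avu)
        (trans (≡-sym (F-blank v cv)) (trans (≡-sym Fu≡Fv) (F-neighbour v u cv avu (c u) refl)))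
      by-cases (just a) (just b) cu cv =
        proper u v a auv cu
          (trans cv (cong just (trans (≡-sym (F-colored v b cv)) (trans (≡-sym Fu≡Fv) (F-colored u a cu)))))

module Forests {n : ℕ} (G : Graph n) (acyclic : ¬ Cycle G) where
  open Components G
  open Paths G

  -- Induction on |D|: otherwise v would be the only exit, and the exit found in a component of
  -- D ∖ u for a vertex u next to v would be a second edge from v into the connected set D.
  exit-avoiding : ∀ m (D : VSet n) → count D ≤ m → IsConnected D → Branching D → ∀ d₀ → D d₀ ≡ true →
                  ∀ v → D v ≡ false → ∃ λ w → (boundary D ∖ v) w ≡ true
  exit-avoiding zero D size _ _ d₀ dd₀ _ _ = ⊥-elim (1+n≰n (≤-trans (count-pos D d₀ dd₀) size))
  exit-avoiding (suc m) D size D-conn D-branch d₀ dd₀ v dv with find (boundary D ∖ v)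
  ... | inj₁ exit = exit
  ... | inj₂ none = ⊥-elim absurd
    where
    exit≡v : ∀ d w → D d ≡ true → adj G d w ≡ true → D w ≡ false → w ≡ v
    exit≡v d w dd adw dw with w ≟ v
    ... | yes w≡v = w≡v
    ... | no w≢v = ⊥-elim (true≢false (∖-intro (boundary D) v (boundary-intro D d w dw dd adw) w≢v) (none w))

    near-v : Σ (Fin n) λ u → D u ≡ true × (∀ d → D d ≡ true → adj G d v ≡ true → adj G u v ≡ true)
    near-v with find (λ d → D d ∧ adj G d v)
    ... | inj₁ (u , q) = u , ∧-trueˡ q , λ _ _ _ → ∧-trueʳ {D u} q
    ... | inj₂ none = d₀ , dd₀ , λ d dd adv → ⊥-elim (true≢false (∧-true dd adv) (none d))
    u = proj₁ near-v
    du = proj₁ (proj₂ near-v)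

    next : Σ (Fin n) λ x → x ≢ v × adj G u x ≡ true
    next with D-branch u du
    ... | y₁ , y₂ , y₁≢y₂ , a₁ , a₂ with y₁ ≟ v
    ... | yes refl = y₂ , y₁≢y₂ ∘ ≡-sym , a₂
    ... | no y₁≢v = y₁ , y₁≢v , a₁
    x = proj₁ next

    dx : D x ≡ true
    dx with bool-cases (D x)
    ... | inj₁ dx = dx
    ... | inj₂ ¬dx = ⊥-elim (proj₁ (proj₂ next) (exit≡v u x du (proj₂ (proj₂ next)) ¬dx))

    S = D ∖ u
    D′ = component S x
    sx : S x ≡ true
    sx = ∖-intro D u dx (adj⇒≢ u x (proj₂ (proj₂ next)) ∘ ≡-sym)
    D′⊆S : D′ ⊆ᵇ S
    D′⊆S = component-⊆ S x sx
    D′⊆D : D′ ⊆ᵇ D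
    D′⊆D y h = ∖-⊆ D u y (D′⊆S y h)

    absurd : ⊥
    absurd
      with exit-avoiding m D′ (≤-pred (≤-trans (s≤s (count-mono D′ S D′⊆S)) (≤-trans (count-∖ D u du) size)))
                         (component-connected S x sx) (λ y h → D-branch y (D′⊆D y h)) x (component-root S x) u
                         (≢true⇒false λ h → true≢false (D′⊆S u h) (∖-self D u))
    ... | w , exit with boundary-elim D′ w (∖-⊆ (boundary D′) u w exit)
    ... | ¬D′w , d , d′d , adw with bool-cases (D w)
    ... | inj₁ dw = true≢false (component-step S x d w d′d (∖-intro D u dw (∖-≢ (boundary D′) u exit)) adw) ¬D′w
    ... | inj₂ ¬dw with exit≡v d w (D′⊆D d d′d) adw ¬dw
    ... | refl = ∖-≢ D u (D′⊆S d d′d)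
                   (≡-sym (single-attachment acyclic D u d w du dv (D-conn u d du (D′⊆D d d′d))
                             (trans (sym G w u) (proj₂ (proj₂ near-v) d (D′⊆D d d′d) adw))
                             (trans (sym G w d) adw)))

  module _ (K : VSet n) (v x₀ : Fin n) (K-conn : IsConnected K) (K-branch : Branching K)
           (kv : K v ≡ true) (s₀ : (K ∖ v) x₀ ≡ true) where

    private
      S = K ∖ v
      C = component S x₀
      C⊆S : C ⊆ᵇ S
      C⊆S = component-⊆ S x₀ s₀
      C⊆K : C ⊆ᵇ K
      C⊆K y h = ∖-⊆ K v y (C⊆S y h)
      ¬Cv : C v ≡ false
      ¬Cv = ≢true⇒false λ h → true≢false (C⊆S v h) (∖-self K v)

      -- An edge leaving K from outside C cannot also be seen from C, by single attachment in K.
      lost-exit : ∀ d w → K d ≡ true → C d ≡ false → adj G d w ≡ true → K w ≡ false →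
                  boundary K w ≡ true × boundary C w ≡ false
      lost-exit d w kd ¬cd adw ¬kw = boundary-intro K d w ¬kw kd adw , ≢true⇒false λ h →
        let (_ , z , cz , azw) = boundary-elim C w h in
        true≢false (subst (λ q → C q ≡ true)
                          (single-attachment acyclic K z d w (C⊆K z cz) ¬kw (K-conn z d (C⊆K z cz) kd)
                                             (trans (sym G w z) azw) (trans (sym G w d) adw)) cz) ¬cd

      module Part (y : Fin n) (sy : S y ≡ true) where
        D = component S y
        D⊆S : D ⊆ᵇ S
        D⊆S = component-⊆ S y sy
        D⊆K : D ⊆ᵇ K
        D⊆K q h = ∖-⊆ K v q (D⊆S q h)
        exit : ∃ λ w → (boundary D ∖ v) w ≡ true
        exit = exit-avoiding n D (count≤n D) (component-connected S y sy) (λ q h → K-branch q (D⊆K q h))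
                             y (component-root S y) v (≢true⇒false λ h → true≢false (D⊆S v h) (∖-self K v))

      far-exit : ∀ y → S y ≡ true → C y ≡ false →
                 Σ (Fin n) λ d → Σ (Fin n) λ w → K d ≡ true × C d ≡ false × adj G d w ≡ true × K w ≡ false
      far-exit y sy ¬cy with Part.exit y sy
      ... | w , exit with boundary-elim (Part.D y sy) w (∖-⊆ (boundary (Part.D y sy)) v w exit)
      ... | ¬dw , d , dd , adw = d , w , Part.D⊆K y sy d dd , ¬cd , adw , ¬kw
        where
        ¬cd : C d ≡ false
        ¬cd = ≢true⇒false λ cd → true≢false (component-trans S x₀ d y cd (component-sym S y d sy dd)) ¬cy
        ¬kw : K w ≡ false
        ¬kw = ≢true⇒false λ kw →
          true≢false (component-step S y d w dd (∖-intro K v kw (∖-≢ (boundary (Part.D y sy)) v exit)) adw) ¬dw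

      -- v has a neighbour y ∉ C; the exit lost by C is y itself or, when y ∈ K, an exit of y's part of K ∖ v.
      some-lost-exit : ∃ λ w → boundary K w ≡ true × boundary C w ≡ false
      some-lost-exit with other-neighbour
        where
        other-neighbour : ∃ λ y → C y ≡ false × adj G v y ≡ true
        other-neighbour with K-branch v kv
        ... | y₁ , y₂ , y₁≢y₂ , a₁ , a₂ with bool-cases (C y₁) | bool-cases (C y₂)
        ... | inj₂ c₁ | _ = y₁ , c₁ , a₁
        ... | inj₁ _ | inj₂ c₂ = y₂ , c₂ , a₂
        ... | inj₁ c₁ | inj₁ c₂ =
          ⊥-elim (y₁≢y₂ (single-attachment acyclic C y₁ y₂ v c₁ ¬Cv (component-connected S x₀ s₀ y₁ y₂ c₁ c₂) a₁ a₂))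
      ... | y , ¬cy , avy with bool-cases (K y)
      ... | inj₂ ¬ky = y , lost-exit v y kv ¬Cv avy ¬ky
      ... | inj₁ ky with far-exit y (∖-intro K v ky (adj⇒≢ v y avy ∘ ≡-sym)) ¬cy
      ... | d , w , kd , ¬cd , adw , ¬kw = w , lost-exit d w kd ¬cd adw ¬kw

    -- C gains only the exit v and loses at least one exit of K.
    boundary-component-≤ : count (boundary C) ≤ count (boundary K)
    boundary-component-≤ with some-lost-exit
    ... | w , bKw , ¬bCw =
      ≤-trans (count-≤-except (boundary C) (boundary K ∖ w) v into)
              (≤-trans (≤-reflexive (+-comm _ 1)) (count-∖ (boundary K) w bKw))
      where
      into : ∀ z → z ≢ v → boundary C z ≡ true → (boundary K ∖ w) z ≡ true
      into z z≢v h with boundary-elim C z h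
      ... | ¬cz , x , cx , axz =
        ∖-intro (boundary K) w (boundary-intro K x z ¬kz (C⊆K x cx) axz) λ { refl → true≢false h ¬bCw }
        where
        ¬kz : K z ≡ false
        ¬kz = ≢true⇒false λ kz → true≢false (component-step S x₀ x z cx (∖-intro K v kz z≢v) axz) ¬cz

  -- One step of the centroid walk, from v to a neighbour u inside the heavy part C of K ∖ v.
  private
    module Step (K : VSet n) (K-conn : IsConnected K) (v x₀ u : Fin n) (kv : K v ≡ true)
                (s₀ : (K ∖ v) x₀ ≡ true) (cu : component (K ∖ v) x₀ u ≡ true) (avu : adj G v u ≡ true) where
      S = K ∖ v
      C = component S x₀
      C⊆S : C ⊆ᵇ S
      C⊆S = component-⊆ S x₀ s₀
      C⊆K : C ⊆ᵇ K
      C⊆K y h = ∖-⊆ K v y (C⊆S y h)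
      ¬Cv : C v ≡ false
      ¬Cv = ≢true⇒false λ h → true≢false (C⊆S v h) (∖-self K v)
      ku : K u ≡ true
      ku = C⊆K u cu
      S′ = K ∖ u
      s′v : S′ v ≡ true
      s′v = ∖-intro K u kv (∖-≢ K v (C⊆S u cu) ∘ ≡-sym)
      V = component S′ v

      V-disjoint : ∀ z → V z ≡ true → C z ≡ false
      V-disjoint z vz = proj₁ (component-ind S′ v (λ z → C z ≡ false × K z ≡ true) (¬Cv , kv) closed z vz)
        where
        closed : ∀ x y → C x ≡ false × K x ≡ true → S′ y ≡ true → adj G x y ≡ true → C y ≡ false × K y ≡ true
        closed x y (¬cx , kx) s′y axy = ≢true⇒false cy⇒⊥ , ∖-⊆ K u y s′y
          where
          cy⇒⊥ : C y ≡ true → ⊥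
          cy⇒⊥ cy with x ≟ v
          ... | yes refl = ∖-≢ K u s′y (≡-sym (single-attachment acyclic C u y v cu ¬Cv
                                          (component-connected S x₀ s₀ u y cu cy) avu axy))
          ... | no x≢v = true≢false (component-step S x₀ y x cy (∖-intro K v kx x≢v) (trans (sym G y x) axy)) ¬cx

      V+C≤K : count V + count C ≤ count K
      V+C≤K = count-disjoint V C K (λ y h → ∖-⊆ K u y (component-⊆ S′ v s′v y h)) C⊆K V-disjoint

      reaches-v : ∀ z → S′ z ≡ true → C z ≡ false → V z ≡ true
      reaches-v z s′z ¬cz with z ≟ v
      ... | yes refl = component-root S′ v
      ... | no z≢v with component-meets-neighbour K v z K-conn kv sz
        where sz = ∖-intro K v (∖-⊆ K u z s′z) z≢v
      ... | y , zy , avy = component-trans S′ v y z vy (component-mono S S′ y D⊆S′ z (component-sym S z y sz zy))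
        where
        sz = ∖-intro K v (∖-⊆ K u z s′z) z≢v
        D⊆S′ : component S y ⊆ᵇ S′
        D⊆S′ q yq = ∖-intro K u (∖-⊆ K v q (component-⊆ S z sz q zq)) λ { refl →
                      true≢false (component-trans S x₀ u z cu (component-sym S z u sz zq)) ¬cz }
          where zq = component-trans S z y q zy yq
        vy : V y ≡ true
        vy = component-step S′ v v y (component-root S′ v) (D⊆S′ y (component-root S y)) avy

      other-parts-⊆ : ∀ x₁ → S′ x₁ ≡ true → V x₁ ≡ false → component S′ x₁ ⊆ᵇ (C ∖ u)
      other-parts-⊆ x₁ s₁ ¬vx₁ z x₁z with bool-cases (C z)
      ... | inj₁ cz = ∖-intro C u cz (∖-≢ K u (component-⊆ S′ x₁ s₁ z x₁z))
      ... | inj₂ ¬cz = ⊥-elim (true≢false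
            (component-trans S′ v z x₁ (reaches-v z (component-⊆ S′ x₁ s₁ z x₁z) ¬cz) (component-sym S′ x₁ z s₁ x₁z))
            ¬vx₁)

  Heavy : VSet n → Fin n → Fin n → Set
  Heavy K v x₀ = (K ∖ v) x₀ ≡ true × count K < 2 * count (component (K ∖ v) x₀)

  -- Walking towards the heavy part strictly shrinks the heavy part, so the walk stops at a centroid.
  centroid : (K : VSet n) (k₀ : Fin n) → K k₀ ≡ true → IsConnected K →
             Σ (Fin n) λ v → K v ≡ true × (∀ x₀ → (K ∖ v) x₀ ≡ true → 2 * count (component (K ∖ v) x₀) ≤ count K)
  centroid K k₀ kk₀ K-conn = walk n k₀ kk₀ (λ _ _ → count≤n _)
    where
    heavy? : ∀ v x₀ → Dec (Heavy K v x₀)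
    heavy? v x₀ = ((K ∖ v) x₀ Bool.≟ true) ×-dec (count K <? 2 * count (component (K ∖ v) x₀))

    half-bound : ∀ a b s → a + b ≤ s → s < 2 * b → 2 * a < s
    half-bound a b s a+b≤s s<2b = +-cancelʳ-< s (2 * a) s
      (<-≤-trans (+-monoʳ-< (2 * a) s<2b)
        (≤-trans (≤-reflexive (≡-sym (*-distribˡ-+ 2 a b)))
          (≤-trans (*-monoʳ-≤ 2 a+b≤s) (≤-reflexive (cong (s +_) (+-identityʳ s))))))

    walk : ∀ m v → K v ≡ true → (∀ x₀ → Heavy K v x₀ → count (component (K ∖ v) x₀) ≤ m) →
           Σ (Fin n) λ v → K v ≡ true × (∀ x₀ → (K ∖ v) x₀ ≡ true → 2 * count (component (K ∖ v) x₀) ≤ count K)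
    walk m v kv bound with any? (heavy? v)
    ... | no light = v , kv , λ x₀ s₀ → ≮⇒≥ λ big → light (x₀ , s₀ , big)
    ... | yes (x₀ , s₀ , big) with m | bound x₀ (s₀ , big)
    ...   | zero | ≤0 = ⊥-elim (1+n≰n (≤-trans (count-pos _ x₀ (component-root (K ∖ v) x₀)) ≤0))
    ...   | suc m | ≤m with component-meets-neighbour K v x₀ K-conn kv s₀
    ...     | u , cu , avu = walk m u (C⊆K u cu) bound′
      where
      open Step K K-conn v x₀ u kv s₀ cu avu
      bound′ : ∀ x₁ → Heavy K u x₁ → count (component S′ x₁) ≤ m
      bound′ x₁ (s₁ , big₁) with bool-cases (V x₁)
      ... | inj₁ vx₁ = ⊥-elim (<-asym big₁ (≤-<-trans
              (*-monoʳ-≤ 2 (count-mono (component S′ x₁) V λ z x₁z → component-trans S′ v x₁ z vx₁ x₁z))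
              (half-bound (count V) (count C) (count K) V+C≤K big)))
      ... | inj₂ ¬vx₁ = ≤-pred (≤-trans (s≤s (count-mono _ _ (other-parts-⊆ x₁ s₁ ¬vx₁))) (≤-trans (count-∖ C u cu) ≤m))

module BadRegions {n : ℕ} (G : Graph n) (acyclic : ¬ Cycle G) where
  open Components G
  open Colorings G
  open Forests G acyclic

  record BadRegion (c : PartialColoring n) (K : VSet n) : Set where
    field
      uncolored : ∀ x → K x ≡ true → c x ≡ nothing
      maximal   : ∀ x y → K x ≡ true → adj G x y ≡ true → c y ≡ nothing → K y ≡ true
      connected : IsConnected K
      branching : Branching K
      bad       : ¬ Colorable K c
  open BadRegion

  colored-outside : ∀ {c K} → BadRegion c K → ∀ y b → c y ≡ just b → K y ≡ false
  colored-outside R y b cy = ≢true⇒false λ ky → just≢nothing (trans (≡-sym cy) (uncolored R y ky))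

  exits-colored : ∀ {c K} → BadRegion c K → ∀ x y → K x ≡ true → adj G x y ≡ true → K y ≡ false →
                  ∃ λ b → c y ≡ just b
  exits-colored {c} R x y kx axy ¬ky with c y in cy
  ... | just b = b , refl
  ... | nothing = ⊥-elim (true≢false (maximal R x y kx axy cy) ¬ky)

  nonempty : ∀ {c K} → BadRegion c K → ∃ λ x → K x ≡ true
  nonempty {c} {K} R with find K
  ... | inj₁ x = x
  ... | inj₂ none = ⊥-elim (bad R ((λ _ → red) , λ x _ kx _ → ⊥-elim (true≢false kx (none x))))

  erase-off-boundary : ∀ {c K} → BadRegion c K → ∀ e b → c e ≡ just b → boundary K e ≡ false →
                       BadRegion (erase (just e) c) K
  erase-off-boundary {c} {K} R e b ce ¬be = record
    { uncolored = uncolored′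
    ; maximal = λ x y kx axy h → maximal R x y kx axy (trans (≡-sym (unchanged x y kx axy)) h)
    ; connected = connected R
    ; branching = branching R
    ; bad = λ { (f , hf) → bad R (f , λ x y kx axy → proj₁ (hf x y kx axy) ,
                                   λ a cy → proj₂ (hf x y kx axy) a (trans (unchanged x y kx axy) cy)) } }
    where
    unchanged : ∀ x y → K x ≡ true → adj G x y ≡ true → erase (just e) c y ≡ c y
    unchanged x y kx axy =
      erase-other c λ { refl → true≢false (boundary-intro K x e (colored-outside R e b ce) kx axy) ¬be }
    uncolored′ : ∀ x → K x ≡ true → erase (just e) c x ≡ nothing
    uncolored′ x kx with x ≟ e
    ... | yes refl = refl
    ... | no _ = uncolored R x kx

  Free : PartialColoring n → Fin n → Color → Set
  Free c v a = ∀ y → adj G v y ≡ true → c y ≢ just a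

  colorable-extend : ∀ {c K} → BadRegion c K → ∀ v a → K v ≡ true → Free c v a →
                     Colorable (K ∖ v) (assign v a c) → Colorable K c
  colorable-extend {c} {K} R v a kv free (g , hg) = f , colors
    where
    f : Fin n → Color
    f y = if y == v then a else fromMaybe (g y) (c y)

    f-self : f v ≡ a
    f-self rewrite ==-refl v = refl
    f-other : ∀ y → y ≢ v → f y ≡ fromMaybe (g y) (c y)
    f-other y y≢v rewrite ≢⇒== y≢v = refl
    f-colored : ∀ y b → c y ≡ just b → f y ≡ b
    f-colored y b cy = trans (f-other y (λ { refl → just≢nothing (trans (≡-sym cy) (uncolored R v kv)) }))
                             (cong (fromMaybe (g y)) cy)
    f-inside : ∀ y → (K ∖ v) y ≡ true → f y ≡ g y
    f-inside y sy = trans (f-other y (∖-≢ K v sy)) (cong (fromMaybe (g y)) (uncolored R y (∖-⊆ K v y sy)))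
    g-self : ∀ x → (K ∖ v) x ≡ true → adj G x v ≡ true → g v ≡ a
    g-self x sx axv = proj₂ (hg x v sx axv) a (assign-self v a c)
    g-outside : ∀ x y b → (K ∖ v) x ≡ true → adj G x y ≡ true → y ≢ v → c y ≡ just b → g y ≡ b
    g-outside x y b sx axy y≢v cy = proj₂ (hg x y sx axy) b (trans (assign-other a c y≢v) cy)

    from-v : ∀ y → adj G v y ≡ true → ∀ m → c y ≡ m → a ≢ f y
    from-v y avy (just b) cy a≡fy = free y avy (trans cy (cong just (trans (≡-sym (f-colored y b cy)) (≡-sym a≡fy))))
    from-v y avy nothing cy a≡fy =
      proj₁ (hg y v sy ayv) (trans (≡-sym (f-inside y sy)) (trans (≡-sym a≡fy) (≡-sym (g-self y sy ayv))))
      where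
      ayv = trans (sym G y v) avy
      sy = ∖-intro K v (maximal R v y kv avy cy) (adj⇒≢ v y avy ∘ ≡-sym)

    off-v : ∀ x y → (K ∖ v) x ≡ true → adj G x y ≡ true → y ≢ v → ∀ m → c y ≡ m → f y ≡ g y
    off-v x y sx axy y≢v (just b) cy = trans (f-colored y b cy) (≡-sym (g-outside x y b sx axy y≢v cy))
    off-v x y sx axy y≢v nothing cy = trans (f-other y y≢v) (cong (fromMaybe (g y)) cy)

    proper : ∀ x y → K x ≡ true → adj G x y ≡ true → Dec (x ≡ v) → Dec (y ≡ v) → f x ≢ f y
    proper x y kx axy (yes refl) _ = λ fv≡fy → from-v y axy (c y) refl (trans (≡-sym f-self) fv≡fy)
    proper x y kx axy (no x≢v) (yes refl) = λ fx≡fv →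
      proj₁ (hg x v sx axy) (trans (≡-sym (f-inside x sx)) (trans fx≡fv (trans f-self (≡-sym (g-self x sx axy)))))
      where sx = ∖-intro K v kx x≢v
    proper x y kx axy (no x≢v) (no y≢v) = λ fx≡fy →
      proj₁ (hg x y sx axy) (trans (≡-sym (f-inside x sx)) (trans fx≡fy (off-v x y sx axy y≢v (c y) refl)))
      where sx = ∖-intro K v kx x≢v

    colors : ColorsAt K c f
    colors x y kx axy = proper x y kx axy (x ≟ v) (y ≟ v) , f-colored y

  bad-part : ∀ {c K} → BadRegion c K → ∀ v a → K v ≡ true → Free c v a →
             ∃ λ x₀ → (K ∖ v) x₀ ≡ true × BadRegion (assign v a c) (component (K ∖ v) x₀)
  bad-part {c} {K} R v a kv free with colorable-or-bad-component (K ∖ v) (assign v a c) exits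
    where
    exits : ∀ x y → (K ∖ v) x ≡ true → adj G x y ≡ true → (K ∖ v) y ≡ false → ∃ λ b → assign v a c y ≡ just b
    exits x y sx axy ¬sy = exit-at (y ≟ v)
      where
      exit-at : Dec (y ≡ v) → ∃ λ b → assign v a c y ≡ just b
      exit-at (yes y≡v) = a , subst (λ q → assign v a c q ≡ just a) (≡-sym y≡v) (assign-self v a c)
      exit-at (no y≢v)
        with exits-colored R x y (∖-⊆ K v x sx) axy (≢true⇒false λ ky → true≢false (∖-intro K v ky y≢v) ¬sy)
      ... | b , cy = b , trans (assign-other a c y≢v) cy
  ... | inj₁ colorable = ⊥-elim (bad R (colorable-extend R v a kv free colorable))
  ... | inj₂ (x₀ , s₀ , bad₀) = x₀ , s₀ , record
    { uncolored = λ x cx → trans (assign-other a c (∖-≢ K v (C⊆S x cx))) (uncolored R x (∖-⊆ K v x (C⊆S x cx)))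
    ; maximal = maximal′
    ; connected = component-connected S x₀ s₀
    ; branching = λ x cx → branching R x (∖-⊆ K v x (C⊆S x cx))
    ; bad = bad₀ }
    where
    S = K ∖ v
    C⊆S = component-⊆ S x₀ s₀
    maximal′ : ∀ x y → component S x₀ x ≡ true → adj G x y ≡ true → assign v a c y ≡ nothing → component S x₀ y ≡ true
    maximal′ x y cx axy h = inside (y ≟ v)
      where
      inside : Dec (y ≡ v) → component S x₀ y ≡ true
      inside (yes y≡v) =
        ⊥-elim (just≢nothing (trans (≡-sym (assign-self v a c)) (subst (λ q → assign v a c q ≡ nothing) y≡v h)))
      inside (no y≢v) = component-step S x₀ x y cx
        (∖-intro K v (maximal R x y (∖-⊆ K v x (C⊆S x cx)) axy (trans (≡-sym (assign-other a c y≢v)) h)) y≢v) axy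

  colored-neighbour? : (c : PartialColoring n) (v : Fin n) (a : Color) →
                       Dec (∃ λ y → adj G v y ≡ true × c y ≡ just a)
  colored-neighbour? c v a = any? λ y → (adj G v y Bool.≟ true) ×-dec (c y ≟ᵐ just a)

  free-or-rainbow : (c : PartialColoring n) (v : Fin n) →
                    (∃ λ a → Free c v a) ⊎ (∀ a → ∃ λ y → adj G v y ≡ true × c y ≡ just a)
  free-or-rainbow c v with colored-neighbour? c v red | colored-neighbour? c v blue | colored-neighbour? c v green
  ... | no ¬r | _ | _ = inj₁ (red , λ y avy cy → ¬r (y , avy , cy))
  ... | yes _ | no ¬b | _ = inj₁ (blue , λ y avy cy → ¬b (y , avy , cy))
  ... | yes _ | yes _ | no ¬g = inj₁ (green , λ y avy cy → ¬g (y , avy , cy))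
  ... | yes r | yes b | yes g = inj₂ λ { red → r ; blue → b ; green → g }

  part-smaller : ∀ {K} v x₀ → K v ≡ true → (K ∖ v) x₀ ≡ true → count (component (K ∖ v) x₀) < count K
  part-smaller {K} v x₀ kv s₀ = ≤-<-trans (count-mono _ _ (component-⊆ (K ∖ v) x₀ s₀)) (count-∖ K v kv)

  -- A vertex of K either sees three colours, giving three exits, or can be coloured so that a bad part remains.
  three-exits : ∀ m {c K} → count K ≤ m → BadRegion c K → 3 ≤ count (boundary K)
  three-exits zero {c} {K} size R with nonempty R
  ... | v , kv = ⊥-elim (1+n≰n (≤-trans (count-pos K v kv) size))
  three-exits (suc m) {c} {K} size R with nonempty R
  ... | v , kv with free-or-rainbow c v
  ... | inj₂ sees with sees red | sees blue | sees green
  ...   | yr , ar , cr | yb , ab , cb | yg , ag , cg =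
    three-members (boundary K) yr yb yg (distinct cr cb λ ()) (distinct cr cg λ ()) (distinct cb cg λ ())
                  (exit yr red ar cr) (exit yb blue ab cb) (exit yg green ag cg)
    where
    distinct : ∀ {p q a b} → c p ≡ just a → c q ≡ just b → a ≢ b → p ≢ q
    distinct cp cq a≢b refl = a≢b (Maybe.just-injective (trans (≡-sym cp) cq))
    exit : ∀ y a → adj G v y ≡ true → c y ≡ just a → boundary K y ≡ true
    exit y a avy cy = boundary-intro K v y (colored-outside R y a cy) kv avy
  three-exits (suc m) {c} {K} size R | v , kv | inj₁ (a , free) with bad-part R v a kv free
  ... | x₀ , s₀ , R′ = ≤-trans (three-exits m (≤-pred (<-≤-trans (part-smaller v x₀ kv s₀) size)) R′)
                               (boundary-component-≤ K v x₀ (connected R) (branching R) kv s₀)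

module Strategy {n : ℕ} (G : Graph n) (acyclic : ¬ Cycle G) (k : ℕ) where
  open Components G
  open Forests G acyclic
  open BadRegions G acyclic
  open BadRegion

  make-room : ∀ {c K} → BadRegion c K → count (boundary K) < k → numColored c ≤ k →
              Σ (Maybe (Fin n)) λ e → BadRegion (erase e c) K × count (colored (erase e c)) < k
  make-room {c} {K} R exits<k colored≤k with count (colored c) <? k
  ... | yes room = nothing , R , room
  ... | no full with find (λ y → colored c y ∧ not (boundary K y))
  ... | inj₂ none = ⊥-elim (full (≤-<-trans (count-mono (colored c) (boundary K) on-boundary) exits<k))
    where
    on-boundary : colored c ⊆ᵇ boundary K
    on-boundary y h = ¬-not {y = false} λ ¬by → true≢false (∧-true h (not-false ¬by)) (none y)
  ... | inj₁ (e , h) with is-just-elim (c e) (∧-trueˡ h)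
  ... | b , ce = just e , erase-off-boundary R e b ce (not-true (∧-trueʳ {colored c e} h)) , fewer
    where
    erased⊆ : colored (erase (just e) c) ⊆ᵇ colored c
    erased⊆ y hy with y ≟ e
    ... | yes refl = ∧-trueˡ h
    ... | no y≢e = hy
    fewer : count (colored (erase (just e) c)) < k
    fewer = <-≤-trans (count-< _ _ erased⊆ e (∧-trueˡ h) (cong is-just (erase-self e c)))
                      (≤-trans (≤-reflexive (≡-sym (numColored≡count c))) colored≤k)

  -- Spoiler colours a centroid of the bad region; whatever Duplicator answers, a bad part of at most
  -- half the size and with no more exits remains, and there is always room to colour one more vertex.
  spoiler-wins : ∀ r {c K} → BadRegion c K → count K < 2 ^ r → count (boundary K) < k → numColored c ≤ k →
                 SpoilerWins G k r c
  spoiler-wins zero {c} {K} R size _ _ with nonempty R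
  ... | v , kv = ⊥-elim (1+n≰n (≤-trans (count-pos K v kv) (≤-pred size)))
  spoiler-wins (suc r) {c} {K} R size exits<k colored≤k with nonempty R
  ... | k₀ , kk₀ with centroid K k₀ kk₀ (connected R) | make-room R exits<k colored≤k
  ... | v , kv , balanced | e , R′ , room = move e v (uncolored R′ v kv) (fits red) reply
    where
    c′ = erase e c
    fits : ∀ a → numColored (assign v a c′) ≤ k
    fits a = ≤-trans (≤-reflexive (numColored≡count (assign v a c′)))
                     (≤-trans (count-colored-assign c′ v a) (≤-trans (≤-reflexive (+-comm _ 1)) room))
    reply : ∀ a → SpoilerWins G k r (assign v a c′)
    reply a with colored-neighbour? c′ v a
    ... | yes (y , avy , cy) = improper λ proper →
      proper v y a avy (assign-self v a c′) (trans (assign-other a c′ (adj⇒≢ v y avy ∘ ≡-sym)) cy)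
    ... | no none with bad-part R′ v a kv (λ y avy cy → none (y , avy , cy))
    ... | x₀ , s₀ , R″ = spoiler-wins r R″ (*-cancelˡ-< 2 _ _ (≤-<-trans (balanced x₀ s₀) size))
                           (≤-<-trans (boundary-component-≤ K v x₀ (connected R′) (branching R′) kv s₀) exits<k)
                           (fits a)

module LeafColoredTree {n : ℕ} (T : Graph n) (acyclic : ¬ Cycle T) (c : PartialColoring n)
                       (leaves-colored : ∀ v → is-just (c v) ≡ isLeaf T v) where
  open Components T
  open Colorings T
  open BadRegions T acyclic
  open BadRegion

  blank⇒nothing : ∀ x → blank c x ≡ true → c x ≡ nothing
  blank⇒nothing x h with c x
  ... | nothing = refl

  blank-exits-colored : ∀ x y → blank c x ≡ true → adj T x y ≡ true → blank c y ≡ false → ∃ λ b → c y ≡ just b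
  blank-exits-colored x y _ _ h = is-just-elim (c y) (Bool.not-injective h)

  colored≡leaves : count (colored c) ≡ numLeaves T
  colored≡leaves = trans (count-cong (colored c) (isLeaf T) leaves-colored) (≡-sym (countB≡count (isLeaf T)))

  -- Uncoloured vertices are not leaves, and none is isolated, since a lone vertex is trivially colourable.
  bad-region : ∀ x₀ → blank c x₀ ≡ true → ¬ Colorable (component (blank c) x₀) c →
               BadRegion c (component (blank c) x₀)
  bad-region x₀ s₀ bad′ = record
    { uncolored = λ x kx → blank⇒nothing x (K⊆U x kx)
    ; maximal = λ x y kx axy cy → component-step (blank c) x₀ x y kx (cong (not ∘ is-just) cy) axy
    ; connected = K-conn
    ; branching = branching′
    ; bad = bad′ }
    where
    K = component (blank c) x₀
    K⊆U = component-⊆ (blank c) x₀ s₀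
    K-conn = component-connected (blank c) x₀ s₀
    branching′ : Branching K
    branching′ x kx = non-leaf-branching x (trans (≡-sym (leaves-colored x)) (cong is-just (blank⇒nothing x (K⊆U x kx))))
                                            neighbour
      where
      neighbour : ∃ λ y → adj T x y ≡ true
      neighbour with find (adj T x)
      ... | inj₁ found = found
      ... | inj₂ lonely = ⊥-elim (bad′ (isolated⇒colorable x K-conn kx lonely))

  boundary⊆colored : ∀ {K} → BadRegion c K → boundary K ⊆ᵇ colored c
  boundary⊆colored R y h with boundary-elim _ y h
  ... | ¬ky , x , kx , axy with c y in cy
  ... | just _ = refl
  ... | nothing = ⊥-elim (true≢false (maximal R x y kx axy cy) ¬ky)

  region-size : ∀ {K} → BadRegion c K → K ⊆ᵇ blank c → count K + numLeaves T ≤ n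
  region-size {K} R K⊆U = begin
    count K + numLeaves T                   ≤⟨ +-monoˡ-≤ _ (count-mono K (blank c) K⊆U) ⟩
    count (blank c) + numLeaves T           ≡⟨ cong (count (blank c) +_) (≡-sym colored≡leaves) ⟩
    count (blank c) + count (colored c)     ≡⟨ +-comm (count (blank c)) _ ⟩
    count (colored c) + count (blank c)     ≡⟨ count-complement (colored c) ⟩
    n                                       ∎
    where open ≤-Reasoning

  exits≤leaves : ∀ {K} → BadRegion c K → count (boundary K) ≤ numLeaves T
  exits≤leaves R = ≤-trans (count-mono _ _ (boundary⊆colored R)) (≤-reflexive colored≡leaves)

  region+3≤n : ∀ {K} → BadRegion c K → K ⊆ᵇ blank c → count K + 3 ≤ n
  region+3≤n {K} R K⊆U =
    ≤-trans (+-monoʳ-≤ (count K) (≤-trans (three-exits n (count≤n K) R) (exits≤leaves R))) (region-size R K⊆U)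

m+3≤n+2⇒m<n : ∀ m n → m + 3 ≤ n + 2 → m < n
m+3≤n+2⇒m<n m n h = +-cancelʳ-≤ 2 (suc m) n (≤-trans (≤-reflexive (≡-sym (+-suc m 2))) h)

lemma5 : (k r n : ℕ) (T : Graph n) → IsTree T →
         n ≤ 2 ^ r + 2 → numLeaves T < k →
         (c : PartialColoring n) → (∀ v → is-just (c v) ≡ isLeaf T v) →
         ¬ Extends T c →
         SpoilerWins T k r c
lemma5 k r n T (_ , _ , acyclic) n≤2ʳ+2 leaves<k c leaves-colored ¬extends with proper? T c
... | no improper-start = improper improper-start
... | yes proper = by-regions (colorable-or-bad-component (blank c) c blank-exits-colored)
  where
  open Components T
  open Colorings T
  open LeafColoredTree T acyclic c leaves-colored
  open Strategy T acyclic k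

  by-regions : Colorable (blank c) c ⊎ (∃ λ x₀ → blank c x₀ ≡ true × ¬ Colorable (component (blank c) x₀) c) →
               SpoilerWins T k r c
  by-regions (inj₁ colorable) = ⊥-elim (¬extends (extends c proper colorable))
  by-regions (inj₂ (x₀ , s₀ , bad)) =
    spoiler-wins r R (m+3≤n+2⇒m<n _ _ (≤-trans (region+3≤n R (component-⊆ (blank c) x₀ s₀)) n≤2ʳ+2))
                 (≤-<-trans (exits≤leaves R) leaves<k)
                 (≤-trans (≤-reflexive (trans (numColored≡count c) colored≡leaves)) (<⇒≤ leaves<k))
    where R = bad-region x₀ s₀ bad
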